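{- Let $Y\subseteq\mathbb{Z}^n$ be contained in some sphere $\{y\in\mathbb{R}^n:\|y\|_2=R\}$ centered at the origin. If $(x_1,\dots,x_6)\in Y^6$ is a solution of the system \[ x_1-x_2-x_3+x_4=0,\quad x_2-x_3-x_4+x_5=0,\quad x_1-2x_2+x_6=0, \] then $x_1=x_2=\cdots=x_6$.
   Context: $\|\cdot\|_2$ is the Euclidean norm on $\mathbb{R}^n\supseteq\mathbb{Z}^n$; the equations hold in $\mathbb{Z}^n$. -}

module Defs where

open import Data.Nat using (ℕ)
open import Data.Integer using (ℤ; _+_; _-_; _*_)
open import Data.Vec using (Vec; zipWith; map; replicate; foldr′)

ℤ^ : ℕ → Set
ℤ^ n = Vec ℤ n

infixl 6 _⊕_ _⊖_
_⊕_ : {n : ℕ} → ℤ^ n → ℤ^ n → ℤ^ n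
_⊕_ = zipWith _+_

_⊖_ : {n : ℕ} → ℤ^ n → ℤ^ n → ℤ^ n
_⊖_ = zipWith _-_

infixl 7 _·_
_·_ : {n : ℕ} → ℤ → ℤ^ n → ℤ^ n
c · v = map (c *_) v

𝟎 : {n : ℕ} → ℤ^ n
𝟎 = replicate _ (Data.Integer.+ 0)

‖_‖² : {n : ℕ} → ℤ^ n → ℤ
‖ v ‖² = foldr′ _+_ (Data.Integer.+ 0) (map (λ a → a * a) v)

-- Y ⊆ ℤ^n lies on a sphere centred at the origin: all points have the same
-- squared norm (‖y‖₂ = R  ⇔  ‖y‖₂² = R², and R² is an integer whenever Y ≠ ∅).
OnSphere : {n : ℕ} → (ℤ^ n → Set) → Set
OnSphere {n} Y = Σ ℤ λ c → (y : ℤ^ n) → Y y → ‖ y ‖² ≡ c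
  where open import Data.Product using (Σ)
        open import Relation.Binary.PropositionalEquality using (_≡_)

module Submission where

-- If b is the midpoint of a and d, the parallelogram law gives
-- 2‖b − a‖² + 2‖b‖² = ‖a‖² + ‖d‖²; when a, b and d lie on one sphere this forces
-- ‖b − a‖² = 0, so a = b = d.  Adding the first two equations shows that x₃ is the
-- midpoint of x₁ and x₅, and the third says that x₂ is the midpoint of x₁ and x₆;
-- hence x₁ = x₂ = x₃ = x₅ = x₆, and then x₂ is also the midpoint of x₁ and x₄.

open import Defs
open import Data.Nat using (ℕ; z≤n) renaming (_+_ to _+ℕ_)
import Data.Nat.Properties as ℕ
open import Data.Integer using (ℤ; +_; 0ℤ; _+_; _-_; _*_; _≤_; +≤+; +0; +[1+_]; -[1+_])
open import Data.Integer.Properties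
  using (+-injective; +-inverseʳ; +-mono-≤; i-j≡0⇒i≡j; i*j≡0⇒i≡0∨j≡0; *-cancelˡ-≡)
open import Data.Integer.Tactic.RingSolver using (solve-∀)
open import Data.Vec using ([]; _∷_)
open import Data.Vec.Properties using (∷-injective)
open import Data.Product using (_×_; _,_; proj₁; proj₂)
open import Data.Sum using ([_,_]′)
open import Function using (id)
open import Relation.Binary.PropositionalEquality
  using (_≡_; refl; sym; trans; cong; cong₂; subst; module ≡-Reasoning)

0≤i*i : ∀ i → 0ℤ ≤ i * i
0≤i*i +0       = +≤+ z≤n
0≤i*i +[1+ m ] = +≤+ z≤n
0≤i*i -[1+ m ] = +≤+ z≤n

i*i≡0⇒i≡0 : ∀ i → i * i ≡ 0ℤ → i ≡ 0ℤ
i*i≡0⇒i≡0 i eq = [ id , id ]′ (i*j≡0⇒i≡0∨j≡0 i eq)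

nonNeg-sum≡0 : ∀ {i j} → 0ℤ ≤ i → 0ℤ ≤ j → i + j ≡ 0ℤ → i ≡ 0ℤ × j ≡ 0ℤ
nonNeg-sum≡0 {+ m} {+ n} _ _ eq =
  cong +_ (ℕ.m+n≡0⇒m≡0 m m+n≡0) , cong +_ (ℕ.m+n≡0⇒n≡0 m m+n≡0)
  where
  m+n≡0 : m +ℕ n ≡ 0
  m+n≡0 = +-injective eq

midpoint-parallelogram : ∀ a b d → a - (+ 2) * b + d ≡ 0ℤ →
  (+ 2) * ((b - a) * (b - a)) + (+ 2) * (b * b) ≡ d * d + a * a
midpoint-parallelogram a b d eq =
  subst (λ d → _ ≡ d * d + a * a) (sym d≡2b-a) (identity a b)
  where
  d≡2b-a : d ≡ (+ 2) * b - a
  d≡2b-a = i-j≡0⇒i≡j d ((+ 2) * b - a) (trans (shuffle a b d) eq)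
    where
    shuffle : ∀ a b d → d - ((+ 2) * b - a) ≡ a - (+ 2) * b + d
    shuffle = solve-∀
  identity : ∀ a b →
    (+ 2) * ((b - a) * (b - a)) + (+ 2) * (b * b) ≡ ((+ 2) * b - a) * ((+ 2) * b - a) + a * a
  identity = solve-∀

⊖≡𝟎⇒≡ : ∀ {n} (u v : ℤ^ n) → u ⊖ v ≡ 𝟎 → u ≡ v
⊖≡𝟎⇒≡ []      []      _  = refl
⊖≡𝟎⇒≡ (x ∷ u) (y ∷ v) eq =
  cong₂ _∷_ (i-j≡0⇒i≡j x y (proj₁ (∷-injective eq))) (⊖≡𝟎⇒≡ u v (proj₂ (∷-injective eq)))

‖‖²-nonNeg : ∀ {n} (v : ℤ^ n) → 0ℤ ≤ ‖ v ‖²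
‖‖²-nonNeg []      = +≤+ z≤n
‖‖²-nonNeg (x ∷ v) = +-mono-≤ (0≤i*i x) (‖‖²-nonNeg v)

‖‖²≡0⇒≡𝟎 : ∀ {n} (v : ℤ^ n) → ‖ v ‖² ≡ 0ℤ → v ≡ 𝟎
‖‖²≡0⇒≡𝟎 []      _  = refl
‖‖²≡0⇒≡𝟎 (x ∷ v) eq with nonNeg-sum≡0 (0≤i*i x) (‖‖²-nonNeg v) eq
... | x*x≡0 , ‖v‖²≡0 = cong₂ _∷_ (i*i≡0⇒i≡0 x x*x≡0) (‖‖²≡0⇒≡𝟎 v ‖v‖²≡0)

parallelogram : ∀ {n} (a b d : ℤ^ n) → a ⊖ (+ 2) · b ⊕ d ≡ 𝟎 →
  (+ 2) * ‖ b ⊖ a ‖² + (+ 2) * ‖ b ‖² ≡ ‖ d ‖² + ‖ a ‖²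
parallelogram []      []      []      _  = refl
parallelogram (x ∷ a) (y ∷ b) (z ∷ d) eq =
  trans (regroup ((y - x) * (y - x)) (y * y) ‖ b ⊖ a ‖² ‖ b ‖²)
        (trans (cong₂ _+_ (midpoint-parallelogram x y z (proj₁ (∷-injective eq)))
                          (parallelogram a b d (proj₂ (∷-injective eq))))
               (regroup′ (z * z) (x * x) ‖ d ‖² ‖ a ‖²))
  where
  regroup : ∀ p q P Q →
    (+ 2) * (p + P) + (+ 2) * (q + Q) ≡ ((+ 2) * p + (+ 2) * q) + ((+ 2) * P + (+ 2) * Q)
  regroup = solve-∀
  regroup′ : ∀ r s R S → (r + s) + (R + S) ≡ (r + R) + (s + S)
  regroup′ = solve-∀

midpoint-of-self : ∀ {n} (a d : ℤ^ n) → a ⊖ (+ 2) · a ⊕ d ≡ 𝟎 → a ≡ d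
midpoint-of-self []      []      _  = refl
midpoint-of-self (x ∷ a) (y ∷ d) eq =
  cong₂ _∷_ (sym (i-j≡0⇒i≡j y x (trans (shuffle x y) (proj₁ (∷-injective eq)))))
            (midpoint-of-self a d (proj₂ (∷-injective eq)))
  where
  shuffle : ∀ x y → y - x ≡ x - (+ 2) * x + y
  shuffle = solve-∀

midpoint-on-sphere : ∀ {n} {c} (a b d : ℤ^ n) → ‖ a ‖² ≡ c → ‖ b ‖² ≡ c → ‖ d ‖² ≡ c →
  a ⊖ (+ 2) · b ⊕ d ≡ 𝟎 → a ≡ b × a ≡ d
midpoint-on-sphere {c = c} a b d ‖a‖²≡c ‖b‖²≡c ‖d‖²≡c eq = a≡b , a≡d
  where
  open ≡-Reasoning
  X : ℤ
  X = ‖ b ⊖ a ‖²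
  2X+2c≡c+c : (+ 2) * X + (+ 2) * c ≡ c + c
  2X+2c≡c+c = trans (cong (λ t → (+ 2) * X + (+ 2) * t) (sym ‖b‖²≡c))
                    (trans (parallelogram a b d eq) (cong₂ _+_ ‖d‖²≡c ‖a‖²≡c))
  cancel : ∀ X c → (+ 2) * X ≡ ((+ 2) * X + (+ 2) * c) - (c + c)
  cancel = solve-∀
  2X≡0 : (+ 2) * X ≡ 0ℤ
  2X≡0 = begin
    (+ 2) * X                         ≡⟨ cancel X c ⟩
    ((+ 2) * X + (+ 2) * c) - (c + c) ≡⟨ cong (_- (c + c)) 2X+2c≡c+c ⟩
    (c + c) - (c + c)                 ≡⟨ +-inverseʳ (c + c) ⟩
    0ℤ                                ∎
  a≡b : a ≡ b
  a≡b = sym (⊖≡𝟎⇒≡ b a (‖‖²≡0⇒≡𝟎 (b ⊖ a) (*-cancelˡ-≡ (+ 2) X 0ℤ 2X≡0)))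
  a≡d : a ≡ d
  a≡d = midpoint-of-self a d (subst (λ b → a ⊖ (+ 2) · b ⊕ d ≡ 𝟎) (sym a≡b) eq)

midpoint-within-sphere : ∀ {n} {Y : ℤ^ n → Set} → OnSphere Y → ∀ {a b d} →
  Y a → Y b → Y d → a ⊖ (+ 2) · b ⊕ d ≡ 𝟎 → a ≡ b × a ≡ d
midpoint-within-sphere (_ , onY) {a} {b} {d} ya yb yd =
  midpoint-on-sphere a b d (onY a ya) (onY b yb) (onY d yd)

sum-of-first-two-equations : ∀ {n} (x₁ x₂ x₃ x₄ x₅ : ℤ^ n) →
  x₁ ⊖ x₂ ⊖ x₃ ⊕ x₄ ≡ 𝟎 → x₂ ⊖ x₃ ⊖ x₄ ⊕ x₅ ≡ 𝟎 → x₁ ⊖ (+ 2) · x₃ ⊕ x₅ ≡ 𝟎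
sum-of-first-two-equations []       []       []       []       []       _  _  = refl
sum-of-first-two-equations (a ∷ x₁) (b ∷ x₂) (c ∷ x₃) (d ∷ x₄) (e ∷ x₅) eq₁ eq₂ =
  cong₂ _∷_ (trans (split a b c d e) (cong₂ _+_ (proj₁ (∷-injective eq₁)) (proj₁ (∷-injective eq₂))))
            (sum-of-first-two-equations x₁ x₂ x₃ x₄ x₅ (proj₂ (∷-injective eq₁)) (proj₂ (∷-injective eq₂)))
  where
  split : ∀ a b c d e → a - (+ 2) * c + e ≡ (a - b - c + d) + (b - c - d + e)
  split = solve-∀

⊖-twice : ∀ {n} (a b : ℤ^ n) → a ⊖ b ⊖ b ≡ a ⊖ (+ 2) · b
⊖-twice []      []      = refl
⊖-twice (x ∷ a) (y ∷ b) = cong₂ _∷_ (identity x y) (⊖-twice a b)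
  where
  identity : ∀ x y → x - y - y ≡ x - (+ 2) * y
  identity = solve-∀

lemma5p6 : (n : ℕ) (Y : ℤ^ n → Set) → OnSphere Y →
    (x₁ x₂ x₃ x₄ x₅ x₆ : ℤ^ n) →
    Y x₁ → Y x₂ → Y x₃ → Y x₄ → Y x₅ → Y x₆ →
    x₁ ⊖ x₂ ⊖ x₃ ⊕ x₄ ≡ 𝟎 →
    x₂ ⊖ x₃ ⊖ x₄ ⊕ x₅ ≡ 𝟎 →
    x₁ ⊖ (+ 2) · x₂ ⊕ x₆ ≡ 𝟎 →
    (x₁ ≡ x₂) × (x₂ ≡ x₃) × (x₃ ≡ x₄) × (x₄ ≡ x₅) × (x₅ ≡ x₆)
lemma5p6 n Y sphere x₁ x₂ x₃ x₄ x₅ x₆ y₁ y₂ y₃ y₄ y₅ y₆ eq₁ eq₂ eq₃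
  with midpoint-within-sphere sphere y₁ y₂ y₆ eq₃
     | midpoint-within-sphere sphere y₁ y₃ y₅ (sum-of-first-two-equations x₁ x₂ x₃ x₄ x₅ eq₁ eq₂)
... | refl , refl | refl , refl
  with midpoint-within-sphere sphere y₁ y₁ y₄ (trans (cong (_⊕ x₄) (sym (⊖-twice x₁ x₁))) eq₁)
... | _ , refl = refl , refl , refl , refl , refl
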